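{- Let $(G,\sigma)$ be a signed graph on $n$ vertices that has a $(2k,2d)$-coloring, where $k,d$ are positive integers with $\gcd(k,d)=1$. If $k>2n$, then $(G,\sigma)$ has a $(k,d)$-coloring.
   Context: Graphs are simple and finite. A signed graph $(G,\sigma)$ is a graph $G$ with a map $\sigma:E(G)\to\{\pm1\}$. For $x\in\mathbb{R}$ and $r>0$, $[x]_r\in[0,r)$ is the remainder of $x$ modulo $r$ and $|x|_r=\min\{[x]_r,[-x]_r\}$. For positive integers $k\ge 2d$, a $(k,d)$-coloring of $(G,\sigma)$ is a map $c:V(G)\to\mathbb{Z}_k$ such that $|c(v)-\sigma(e)c(w)|_k\ge d$ for every edge $e=vw$. -}

module Defs where

open import Data.Nat using (ℕ; zero; suc; _+_; _*_; _∸_; _≤_; _<_; _⊓_; NonZero)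
open import Data.Nat.DivMod using (_%_)
open import Data.Fin using (Fin; toℕ)
open import Data.Empty using (⊥)
open import Relation.Nullary using (¬_)
open import Relation.Binary.PropositionalEquality using (_≡_)
open import Data.Product using (Σ)

data Sign : Set where
  plus minus : Sign

record Graph (n : ℕ) : Set₁ where
  field
    Adj   : Fin n → Fin n → Set
    sym   : ∀ {v w} → Adj v w → Adj w v
    irrefl : ∀ {v} → ¬ Adj v v

record SignedGraph (n : ℕ) : Set₁ where
  field
    graph : Graph n
  open Graph graph public
  field
    σ      : ∀ {v w} → Adj v w → Sign
    σ-sym  : ∀ {v w} (e : Adj v w) → σ (sym e) ≡ σ e

-- [x - s*y]_k for x,y ∈ ℤ_k (represented by Fin k), s = ±1.
residue : (k : ℕ) .{{_ : NonZero k}} → Sign → Fin k → Fin k → ℕ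
residue k plus  x y = (toℕ x + (k ∸ toℕ y)) % k
residue k minus x y = (toℕ x + toℕ y) % k

-- |z|_k = min([z]_k, [-z]_k), where z has remainder r = [z]_k ∈ [0,k);
-- then [-z]_k = k - r if r > 0 and 0 if r = 0; in both cases the minimum
-- equals r ⊓ (k ∸ r).
circ : ℕ → ℕ → ℕ
circ k r = r ⊓ (k ∸ r)

IsColoring : ∀ {n} (G : SignedGraph n) (k d : ℕ) .{{_ : NonZero k}} → (Fin n → Fin k) → Set
IsColoring G k d c = ∀ {v w} (e : SignedGraph.Adj G v w) →
  d ≤ circ k (residue k (SignedGraph.σ G e) (c v) (c w))

HasColoring : ∀ {n} (G : SignedGraph n) (k d : ℕ) .{{_ : NonZero k}} → Set
HasColoring {n} G k d = Σ (Fin n → Fin k) (IsColoring G k d)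

module Submission where

-- Halve the colours: 2α ↦ α, and 2α+1 ↦ α or α+1.  An edge can then only fail
-- if it is tight (its colours are at distance exactly 2d, or 2k−2d) and its two
-- odd ends are rounded the wrong way.  By pigeonhole (k > 2n) there is μ such
-- that no colour is ±(2μ+1).  The affine bijection pos α = d⁻¹(α − μ) of ℤ_k
-- turns α ↦ α+d into a unit step, sends μ to 0 and −μ−1 to a pivot p, and turns
-- −(2α+1) = 2·opp α + 1 into j ↦ p − j.  Rounding 2α+1 up exactly when pos α
-- lies in the upper half of its arc from 0 to p or from p to k makes every
-- tight edge round consistently.

open import Level using (0ℓ)
open import Data.Nat
open import Data.Nat.Properties
open import Data.Nat.DivMod using (_%_; m%n<n; m%n%n≡m%n; n%n≡0; m*n%n≡0; m<n⇒m%n≡m;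
  [m+kn]%n≡m%n; %-distribˡ-+; %-distribˡ-*; %-congʳ; m%n*o≡m*o%[n*o])
open import Data.Nat.GCD using (gcd; module Bézout)
open import Data.Nat.Coprimality using (coprime-Bézout; gcd≡1⇒coprime)
open import Data.Nat.Tactic.RingSolver using (solve-∀)
open import Data.Fin using (Fin; toℕ; fromℕ<; join; splitAt)
open import Data.Fin.Properties using (toℕ<n; toℕ-fromℕ<; toℕ-injective; splitAt-join;
  pigeonhole; any?; all?; ¬∀⟶∃¬)
open import Data.Product using (∃; ∃₂; ∃-syntax; _×_; _,_; proj₁; proj₂)
open import Data.Sum using (_⊎_; inj₁; inj₂)
open import Data.Empty using (⊥-elim)
open import Function using (_∘_)
open import Relation.Nullary using (¬_; Dec; yes; no; contradiction)
open import Relation.Nullary.Decidable using (_×-dec_; _⊎-dec_; ¬?)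
open import Relation.Binary.Bundles using (Setoid)
open import Relation.Binary.Definitions using (tri<; tri≈; tri>)
open import Relation.Binary.PropositionalEquality
import Relation.Binary.Reasoning.Setoid as SetoidReasoning
open import Algebra.Properties.CommutativeSemigroup +-commutativeSemigroup
  using (interchange; xy∙z≈xz∙y; xy∙z≈yz∙x)
open import Defs

infix 4 _≋_mod_
record _≋_mod_ (a b N : ℕ) .{{_ : NonZero N}} : Set where
  constructor mod-≡
  field %-≡ : a % N ≡ b % N

module _ {N : ℕ} .{{_ : NonZero N}} where

  ≋-refl : ∀ {a} → a ≋ a mod N
  ≋-refl = mod-≡ refl

  ≋-sym : ∀ {a b} → a ≋ b mod N → b ≋ a mod N
  ≋-sym (mod-≡ p) = mod-≡ (sym p)

  ≋-trans : ∀ {a b c} → a ≋ b mod N → b ≋ c mod N → a ≋ c mod N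
  ≋-trans (mod-≡ p) (mod-≡ q) = mod-≡ (trans p q)

  ≡⇒≋ : ∀ {a b} → a ≡ b → a ≋ b mod N
  ≡⇒≋ refl = ≋-refl

  %-≋ : ∀ a → a % N ≋ a mod N
  %-≋ a = mod-≡ (m%n%n≡m%n a N)

  N≋0 : N ≋ 0 mod N
  N≋0 = mod-≡ (trans (n%n≡0 N) (sym (m*n%n≡0 0 N)))

  +-cong : ∀ {a b c d} → a ≋ b mod N → c ≋ d mod N → a + c ≋ b + d mod N
  +-cong {a} {b} {c} {d} (mod-≡ p) (mod-≡ q) = mod-≡ (begin
    (a + c) % N             ≡⟨ %-distribˡ-+ a c N ⟩
    (a % N + c % N) % N     ≡⟨ cong₂ (λ u v → (u + v) % N) p q ⟩
    (b % N + d % N) % N     ≡⟨ %-distribˡ-+ b d N ⟨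
    (b + d) % N             ∎)
    where open ≡-Reasoning

  *-cong : ∀ {a b c d} → a ≋ b mod N → c ≋ d mod N → a * c ≋ b * d mod N
  *-cong {a} {b} {c} {d} (mod-≡ p) (mod-≡ q) = mod-≡ (begin
    (a * c) % N             ≡⟨ %-distribˡ-* a c N ⟩
    (a % N * (c % N)) % N   ≡⟨ cong₂ (λ u v → (u * v) % N) p q ⟩
    (b % N * (d % N)) % N   ≡⟨ %-distribˡ-* b d N ⟨
    (b * d) % N             ∎)
    where open ≡-Reasoning

  ≋⇒≡ : ∀ {a b} → a < N → b < N → a ≋ b mod N → a ≡ b
  ≋⇒≡ a<N b<N (mod-≡ p) = trans (sym (m<n⇒m%n≡m a<N)) (trans p (m<n⇒m%n≡m b<N))

≋-setoid : (N : ℕ) .{{_ : NonZero N}} → Setoid 0ℓ 0ℓ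
≋-setoid N = record
  { Carrier       = ℕ
  ; _≈_           = λ a b → a ≋ b mod N
  ; isEquivalence = record { refl = ≋-refl ; sym = ≋-sym ; trans = ≋-trans }
  }

module ≋-Reasoning (N : ℕ) .{{_ : NonZero N}} = SetoidReasoning (≋-setoid N)

module _ {N : ℕ} .{{_ : NonZero N}} where
  open ≋-Reasoning N

  +-cancelʳ-≋ : ∀ a b c → a + c ≋ b + c mod N → a ≋ b mod N
  +-cancelʳ-≋ a b c a+c≋b+c = begin
    a              ≡⟨ +-identityʳ a ⟨
    a + 0          ≈⟨ +-cong ≋-refl c+c′≋0 ⟨
    a + (c + c′)   ≡⟨ +-assoc a c c′ ⟨
    a + c + c′     ≈⟨ +-cong a+c≋b+c ≋-refl ⟩
    b + c + c′     ≡⟨ +-assoc b c c′ ⟩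
    b + (c + c′)   ≈⟨ +-cong ≋-refl c+c′≋0 ⟩
    b + 0          ≡⟨ +-identityʳ b ⟩
    b              ∎
    where
    c′ : ℕ
    c′ = N ∸ c % N
    c+c′≋0 : c + c′ ≋ 0 mod N
    c+c′≋0 = begin
      c + c′         ≈⟨ +-cong (%-≋ c) ≋-refl ⟨
      c % N + c′     ≡⟨ m+[n∸m]≡n (<⇒≤ (m%n<n c N)) ⟩
      N              ≈⟨ N≋0 ⟩
      0              ∎

  +-cancelˡ-≋ : ∀ a b c → c + a ≋ c + b mod N → a ≋ b mod N
  +-cancelˡ-≋ a b c c+a≋c+b = +-cancelʳ-≋ a b c (begin
    a + c   ≡⟨ +-comm a c ⟩
    c + a   ≈⟨ c+a≋c+b ⟩
    c + b   ≡⟨ +-comm c b ⟩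
    b + c   ∎)

  *-cancel-unit : ∀ {a b e u} → e * u ≋ 1 mod N → e * a ≋ e * b mod N → a ≋ b mod N
  *-cancel-unit {a} {b} {e} {u} e*u≋1 ea≋eb = begin
    a              ≡⟨ *-identityˡ a ⟨
    1 * a          ≈⟨ *-cong e*u≋1 ≋-refl ⟨
    e * u * a      ≡⟨ swap e u a ⟩
    u * (e * a)    ≈⟨ *-cong (≋-refl {a = u}) ea≋eb ⟩
    u * (e * b)    ≡⟨ swap e u b ⟨
    e * u * b      ≈⟨ *-cong e*u≋1 ≋-refl ⟩
    1 * b          ≡⟨ *-identityˡ b ⟩
    b              ∎
    where
    swap : ∀ e u a → e * u * a ≡ u * (e * a)
    swap = solve-∀

  ≋⇒≡-≤ : ∀ {a b} → a ≤ N → 0 < b → b < N → a ≋ b mod N → a ≡ b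
  ≋⇒≡-≤ {a} {b} a≤N 0<b b<N a≋b with m≤n⇒m<n∨m≡n a≤N
  ... | inj₁ a<N = ≋⇒≡ a<N b<N a≋b
  ... | inj₂ refl = contradiction (≋⇒≡ 0<N b<N (≋-trans (≋-sym N≋0) a≋b)) (<⇒≢ 0<b)
    where
    0<N : 0 < N
    0<N = ≤-trans 0<b (<⇒≤ b<N)

  ≉-within-period : ∀ {a b} → a < b → b < a + N → ¬ (a ≋ b mod N)
  ≉-within-period {a} {b} a<b b<a+N a≋b = <⇒≢ 0<t (≋⇒≡ 0<N t<N 0≋t)
    where
    t : ℕ
    t = b ∸ a
    a+t≡b : a + t ≡ b
    a+t≡b = m+[n∸m]≡n (<⇒≤ a<b)
    0<t : 0 < t
    0<t = m<n⇒0<n∸m a<b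
    t<N : t < N
    t<N = +-cancelˡ-< a t N (subst (_< a + N) (sym a+t≡b) b<a+N)
    0<N : 0 < N
    0<N = ≤-trans 0<t (<⇒≤ t<N)
    0≋t : 0 ≋ t mod N
    0≋t = +-cancelˡ-≋ 0 t a (begin
      a + 0   ≡⟨ +-identityʳ a ⟩
      a       ≈⟨ a≋b ⟩
      b       ≡⟨ a+t≡b ⟨
      a + t   ∎)

modular-inverse : ∀ {N d} .{{_ : NonZero N}} → gcd N d ≡ 1 → ∃[ e ] e * d ≋ 1 mod N
modular-inverse {N} {d} gcd≡1 with coprime-Bézout (gcd≡1⇒coprime gcd≡1)
... | Bézout.-+ x y 1+xN≡yd = y , (begin
  y * d        ≡⟨ 1+xN≡yd ⟨
  1 + x * N    ≈⟨ mod-≡ ([m+kn]%n≡m%n 1 x N) ⟩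
  1            ∎)
  where open ≋-Reasoning N
... | Bézout.+- x y 1+yd≡xN = k * y , +-cancelʳ-≋ (k * y * d) 1 k (begin
  k * y * d + k     ≡⟨ factor k y d ⟩
  k * (1 + y * d)   ≡⟨ cong (k *_) 1+yd≡xN ⟩
  k * (x * N)       ≡⟨ *-assoc k x N ⟨
  k * x * N         ≈⟨ mod-≡ (trans (m*n%n≡0 (k * x) N) (sym (n%n≡0 N))) ⟩
  N                 ≡⟨ m+[n∸m]≡n (>-nonZero⁻¹ N) ⟨
  1 + k             ∎)
  where
  open ≋-Reasoning N
  -- y * d ≡ −1, so (N − 1) * y ≡ −y inverts d.
  k : ℕ
  k = N ∸ 1
  factor : ∀ k y d → k * y * d + k ≡ k * (1 + y * d)
  factor = solve-∀

2*suc : ∀ n → 2 * suc n ≡ 2 * n + 2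
2*suc n = trans (*-suc 2 n) (+-comm 2 (2 * n))

n+n≡2*n : ∀ n → n + n ≡ 2 * n
n+n≡2*n n = cong (n +_) (sym (+-identityʳ n))

halve-≤ : ∀ a b {c} → c ≤ 2 * a → c ≤ 2 * b → c ≤ a + b
halve-≤ a b {c} c≤2a c≤2b =
  *-cancelˡ-≤ 2 (subst₂ _≤_ (n+n≡2*n c) (sym (*-distribˡ-+ 2 a b)) (+-mono-≤ c≤2a c≤2b))

halve-< : ∀ a b {c} → 2 * a < c → 2 * b < c → a + b < c
halve-< a b {c} 2a<c 2b<c = *-cancelˡ-≤ 2
  (subst₂ _≤_ (shift a b) (n+n≡2*n c) (+-mono-≤ 2a<c 2b<c))
  where
  shift : ∀ a b → suc (2 * a) + suc (2 * b) ≡ 2 * suc (a + b)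
  shift = solve-∀

half-lower-bound : ∀ {d R D p q} → 2 * d ≤ D → 2 * R + p ≡ D + q → p ≤ 2 →
                   (p ≡ 2 → D ≢ 2 * d) → d ≤ R
half-lower-bound {d} {R} {D} {p} {q} 2d≤D 2R+p≡D+q p≤2 tight with d ≤? R
... | yes d≤R = d≤R
... | no d≰R = contradiction D≡2d (tight p≡2)
  where
  2R+2≤2d : 2 * R + 2 ≤ 2 * d
  2R+2≤2d = subst (_≤ 2 * d) (2*suc R) (*-monoʳ-≤ 2 (≰⇒> d≰R))
  2R+2≤D : 2 * R + 2 ≤ D
  2R+2≤D = ≤-trans 2R+2≤2d 2d≤D
  D≤2R+p : D ≤ 2 * R + p
  D≤2R+p = subst (D ≤_) (sym 2R+p≡D+q) (m≤m+n D q)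
  D≡2d : D ≡ 2 * d
  D≡2d = ≤-antisym (≤-trans D≤2R+p (≤-trans (+-monoʳ-≤ (2 * R) p≤2) 2R+2≤2d)) 2d≤D
  p≡2 : p ≡ 2
  p≡2 = ≤-antisym p≤2 (+-cancelˡ-≤ (2 * R) 2 p (≤-trans 2R+2≤D D≤2R+p))

2*[m∸n]+2*n≡2*m : ∀ {m n} → n ≤ m → 2 * (m ∸ n) + 2 * n ≡ 2 * m
2*[m∸n]+2*n≡2*m {m} {n} n≤m =
  trans (sym (*-distribˡ-+ 2 (m ∸ n) n)) (cong (2 *_) (m∸n+n≡m n≤m))

mirror-equation : ∀ {K R D p q} → R ≤ K → D ≤ 2 * K → 2 * R + p ≡ D + q →
                  2 * (K ∸ R) + q ≡ (2 * K ∸ D) + p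
mirror-equation {K} {R} {D} {p} {q} R≤K D≤2K 2R+p≡D+q = +-cancelʳ-≡ (D + q) _ _ (begin
  2 * (K ∸ R) + q + (D + q)        ≡⟨ cong (2 * (K ∸ R) + q +_) 2R+p≡D+q ⟨
  2 * (K ∸ R) + q + (2 * R + p)    ≡⟨ interchange (2 * (K ∸ R)) q (2 * R) p ⟩
  2 * (K ∸ R) + 2 * R + (q + p)    ≡⟨ cong₂ _+_ (2*[m∸n]+2*n≡2*m R≤K) (+-comm q p) ⟩
  2 * K + (p + q)                  ≡⟨ cong (_+ (p + q)) (m∸n+n≡m D≤2K) ⟨
  (2 * K ∸ D) + D + (p + q)        ≡⟨ interchange (2 * K ∸ D) p D q ⟨
  (2 * K ∸ D) + p + (D + q)        ∎)
  where open ≡-Reasoning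

module Doubling (K : ℕ) .{{_ : NonZero K}} where

  M : ℕ
  M = 2 * K

  instance
    M-nonZero : NonZero M
    M-nonZero = m*n≢0 2 K

  double-% : ∀ m → 2 * (m % K) ≡ 2 * m % M
  double-% m = begin
    2 * (m % K)       ≡⟨ *-comm 2 (m % K) ⟩
    m % K * 2         ≡⟨ m%n*o≡m*o%[n*o] m K 2 ⟩
    m * 2 % (K * 2)   ≡⟨ cong (_% (K * 2)) (*-comm m 2) ⟩
    2 * m % (K * 2)   ≡⟨ %-congʳ (*-comm K 2) ⟩
    2 * m % M         ∎
    where
    open ≡-Reasoning
    instance
      K*2-nonZero : NonZero (K * 2)
      K*2-nonZero = m*n≢0 K 2

  double-%-≋ : ∀ m → 2 * (m % K) ≋ 2 * m mod M
  double-%-≋ m = ≋-trans (≡⇒≋ (double-% m)) (%-≋ (2 * m))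

  halve-≋ : ∀ {a b} → 2 * a ≋ 2 * b mod M → a ≋ b mod K
  halve-≋ {a} {b} (mod-≡ 2a≋2b) =
    mod-≡ (*-cancelˡ-≡ (a % K) (b % K) 2 (trans (double-% a) (trans 2a≋2b (sym (double-% b)))))

  halve-odd-≋ : ∀ {a b} → suc (2 * a) ≋ suc (2 * b) mod M → a ≋ b mod K
  halve-odd-≋ {a} {b} eq = halve-≋ (+-cancelˡ-≋ (2 * a) (2 * b) 1 eq)

  odd<⇒< : ∀ {α} → suc (2 * α) < M → α < K
  odd<⇒< {α} 2α+1<M = *-cancelˡ-< 2 α K (<-trans (n<1+n (2 * α)) 2α+1<M)

  opp : ℕ → ℕ
  opp α = K ∸ suc α

  suc+opp : ∀ {α} → α < K → suc α + opp α ≡ K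
  suc+opp α<K = m+[n∸m]≡n α<K

  opp<K : ∀ {α} → α < K → opp α < K
  opp<K α<K = ∸-monoʳ-< z<s α<K

  opp-sum : ∀ {α β} → α < K → β < K → α + opp α ≡ β + opp β
  opp-sum α<K β<K = suc-injective (trans (suc+opp α<K) (sym (suc+opp β<K)))

  opp-injective : ∀ {α β} → α < K → β < K → opp α ≡ opp β → α ≡ β
  opp-injective {α} {β} α<K β<K opp≡ =
    suc-injective (+-cancelʳ-≡ (opp β) (suc α) (suc β)
      (trans (cong (suc α +_) (sym opp≡)) (trans (suc+opp α<K) (sym (suc+opp β<K)))))

  record Halves (h a x b : ℕ) : Set where
    constructor halves
    field congruence : 2 * h + a ≋ x + b mod M

  Halves-+ : ∀ {h a x b h′ a′ x′ b′} → Halves h a x b → Halves h′ a′ x′ b′ →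
             Halves ((h + h′) % K) (a + a′) ((x + x′) % M) (b + b′)
  Halves-+ {h} {a} {x} {b} {h′} {a′} {x′} {b′} (halves e) (halves e′) = halves (begin
    2 * ((h + h′) % K) + (a + a′)   ≈⟨ +-cong (double-%-≋ (h + h′)) ≋-refl ⟩
    2 * (h + h′) + (a + a′)         ≡⟨ regroup h h′ a a′ ⟩
    (2 * h + a) + (2 * h′ + a′)     ≈⟨ +-cong e e′ ⟩
    (x + b) + (x′ + b′)             ≡⟨ interchange x b x′ b′ ⟩
    (x + x′) + (b + b′)             ≈⟨ +-cong (%-≋ (x + x′)) ≋-refl ⟨
    (x + x′) % M + (b + b′)         ∎)
    where
    open ≋-Reasoning M
    regroup : ∀ h h′ a a′ → 2 * (h + h′) + (a + a′) ≡ (2 * h + a) + (2 * h′ + a′)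
    regroup = solve-∀

  Halves-negate : ∀ {h a x b} → Halves h a x b → h ≤ K → x ≤ M → Halves (K ∸ h) b (M ∸ x) a
  Halves-negate {h} {a} {x} {b} (halves e) h≤K x≤M = halves (+-cancelʳ-≋ _ _ (2 * h + a) (begin
    2 * (K ∸ h) + b + (2 * h + a)   ≡⟨ interchange (2 * (K ∸ h)) b (2 * h) a ⟩
    2 * (K ∸ h) + 2 * h + (b + a)   ≡⟨ cong₂ _+_ (2*[m∸n]+2*n≡2*m h≤K) (+-comm b a) ⟩
    M + (a + b)                     ≡⟨ cong (_+ (a + b)) (m∸n+n≡m x≤M) ⟨
    (M ∸ x) + x + (a + b)           ≡⟨ interchange (M ∸ x) a x b ⟨
    (M ∸ x) + a + (x + b)           ≈⟨ +-cong (≋-refl {a = M ∸ x + a}) e ⟨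
    (M ∸ x) + a + (2 * h + a)       ∎))
    where open ≋-Reasoning M

  Halves-exact : ∀ {d R D p q} → 1 ≤ d → R < K → 2 * d ≤ D → D + 2 * d ≤ M → p ≤ 2 → q ≤ 2 →
                 (q ≡ 2 → D + 2 * d ≢ M) → Halves R p D q → 2 * R + p ≡ D + q
  Halves-exact {d} {R} {D} {p} {q} 1≤d R<K 2d≤D D+2d≤M p≤2 q≤2 tight-high (halves 2R+p≋D+q) =
    ≋⇒≡-≤ 2R+p≤M 0<D+q D+q<M 2R+p≋D+q
    where
    2≤2d : 2 ≤ 2 * d
    2≤2d = *-monoʳ-≤ 2 1≤d
    2R+p≤M : 2 * R + p ≤ M
    2R+p≤M = ≤-trans (+-monoʳ-≤ (2 * R) p≤2) (subst (_≤ M) (2*suc R) (*-monoʳ-≤ 2 R<K))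
    0<D+q : 0 < D + q
    0<D+q = ≤-trans (≤-trans (≤-trans (s≤s z≤n) 2≤2d) 2d≤D) (m≤m+n D q)
    D+q≢M : D + q ≢ M
    D+q≢M D+q≡M = tight-high q≡2 (trans (cong (D +_) 2d≡q) D+q≡M)
      where
      2d≤q : 2 * d ≤ q
      2d≤q = +-cancelˡ-≤ D (2 * d) q (subst (D + 2 * d ≤_) (sym D+q≡M) D+2d≤M)
      q≡2 : q ≡ 2
      q≡2 = ≤-antisym q≤2 (≤-trans 2≤2d 2d≤q)
      2d≡q : 2 * d ≡ q
      2d≡q = ≤-antisym 2d≤q (subst (_≤ 2 * d) (sym q≡2) 2≤2d)
    D+q<M : D + q < M
    D+q<M = ≤∧≢⇒< (≤-trans (+-monoʳ-≤ D (≤-trans q≤2 2≤2d)) D+2d≤M) D+q≢M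

  bound : ∀ {d R D p q} → 1 ≤ d → R < K → D < M → 2 * d ≤ circ M D → p ≤ 2 → q ≤ 2 →
          Halves R p D q → (p ≡ 2 → D ≢ 2 * d) → (q ≡ 2 → D + 2 * d ≢ M) →
          d ≤ circ K R
  bound {d} {R} {D} {p} {q} 1≤d R<K D<M 2d≤circ p≤2 q≤2 half tight-low tight-high =
    ⊓-glb (half-lower-bound 2d≤D exact p≤2 tight-low)
          (half-lower-bound 2d≤M∸D (mirror-equation (<⇒≤ R<K) (<⇒≤ D<M) exact) q≤2 tight-high′)
    where
    2d≤D : 2 * d ≤ D
    2d≤D = ≤-trans 2d≤circ (m⊓n≤m D (M ∸ D))
    2d≤M∸D : 2 * d ≤ M ∸ D
    2d≤M∸D = ≤-trans 2d≤circ (m⊓n≤n D (M ∸ D))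
    D+2d≤M : D + 2 * d ≤ M
    D+2d≤M = subst (_≤ M) (+-comm (2 * d) D) (m≤o∸n⇒m+n≤o (2 * d) (<⇒≤ D<M) 2d≤M∸D)
    exact : 2 * R + p ≡ D + q
    exact = Halves-exact 1≤d R<K 2d≤D D+2d≤M p≤2 q≤2 tight-high half
    tight-high′ : q ≡ 2 → M ∸ D ≢ 2 * d
    tight-high′ q≡2 M∸D≡2d =
      tight-high q≡2 (trans (cong (D +_) (sym M∸D≡2d)) (m+[n∸m]≡n (<⇒≤ D<M)))

suc-+-< : ∀ {a b c d} → a < c → b < d → suc (a + b) < c + d
suc-+-< {a} {b} {c} {d} a<c b<d = subst (_≤ c + d) (cong suc (+-suc a b)) (+-mono-≤ a<c b<d)

module Arcs (K p : ℕ) .{{_ : NonZero K}} (p<K : p < K) where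

  Upper : ℕ → Set
  Upper j = (j ≤ p × p ≤ 2 * j) ⊎ (p < j × p + K ≤ 2 * j)

  Lower : ℕ → Set
  Lower j = (j < p × 2 * j < p) ⊎ (p < j × 2 * j < p + K)

  upper? : ∀ j → Dec (Upper j)
  upper? j = (j ≤? p ×-dec p ≤? 2 * j) ⊎-dec (p <? j ×-dec p + K ≤? 2 * j)

  ¬Upper⇒Lower : ∀ {j} → j ≢ p → ¬ Upper j → Lower j
  ¬Upper⇒Lower {j} j≢p ¬up with <-cmp j p
  ... | tri< j<p _ _ = inj₁ (j<p , ≰⇒> λ p≤2j → ¬up (inj₁ (<⇒≤ j<p , p≤2j)))
  ... | tri≈ _ j≡p _ = contradiction j≡p j≢p
  ... | tri> _ _ p<j = inj₂ (p<j , ≰⇒> λ p+K≤2j → ¬up (inj₂ (p<j , p+K≤2j)))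

  Upper-suc : ∀ {j} → j ≢ p → Upper j → Upper (suc j)
  Upper-suc {j} j≢p (inj₁ (j≤p , p≤2j)) =
    inj₁ (≤∧≢⇒< j≤p j≢p , ≤-trans p≤2j (*-monoʳ-≤ 2 (n≤1+n j)))
  Upper-suc {j} _   (inj₂ (p<j , p+K≤2j)) =
    inj₂ (m<n⇒m<1+n p<j , ≤-trans p+K≤2j (*-monoʳ-≤ 2 (n≤1+n j)))

  +≉suc-p : ∀ {a b} → 0 < a → p < b → a + b < p + K → ¬ (a + b ≋ suc p mod K)
  +≉suc-p 0<a p<b a+b<p+K a+b≋ =
    ≉-within-period (+-mono-≤ 0<a p<b) (m<n⇒m<1+n a+b<p+K) (≋-sym a+b≋)

  Lower-pair : ∀ {a b} → 0 < a → 0 < b → a < K → b < K → Lower a → Lower b →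
               ¬ (a + b ≋ suc p mod K)
  Lower-pair {a} {b} 0<a 0<b _ _ (inj₁ (_ , 2a<p)) (inj₁ (_ , 2b<p)) =
    ≉-within-period (m<n⇒m<1+n (halve-< a b 2a<p 2b<p))
                    (≤-<-trans p<K (m<n+m _ (<-≤-trans 0<a (m≤m+n _ _))))
  Lower-pair 0<a _ _ b<K (inj₁ (a<p , _)) (inj₂ (p<b , _)) a+b≋ =
    +≉suc-p 0<a p<b (+-mono-< a<p b<K) a+b≋
  Lower-pair {a} {b} _ 0<b a<K _ (inj₂ (p<a , _)) (inj₁ (b<p , _)) a+b≋ =
    +≉suc-p 0<b p<a (+-mono-< b<p a<K) (≋-trans (≡⇒≋ (+-comm b a)) a+b≋)
  Lower-pair {a} {b} _ 0<b _ _ (inj₂ (p<a , 2a<)) (inj₂ (_ , 2b<)) a+b≋ =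
    +≉suc-p 0<b p<a (subst (_< p + K) (+-comm a b) (halve-< a b 2a< 2b<))
      (≋-trans (≡⇒≋ (+-comm b a)) a+b≋)

  suc-+≉p : ∀ {a b} → a < p → p ≤ 2 * a → p ≤ 2 * b → b < K → ¬ (suc (a + b) ≋ p mod K)
  suc-+≉p {a} {b} a<p p≤2a p≤2b b<K sum≋ =
    ≉-within-period (s≤s (halve-≤ a b p≤2a p≤2b)) (suc-+-< a<p b<K) (≋-sym sum≋)

  Upper-pair : ∀ {a b} → a ≢ p → b ≢ p → a < K → b < K → Upper a → Upper b →
               ¬ (suc (a + b) ≋ p mod K)
  Upper-pair a≢p _ _ b<K (inj₁ (a≤p , p≤2a)) (inj₁ (_ , p≤2b)) =
    suc-+≉p (≤∧≢⇒< a≤p a≢p) p≤2a p≤2b b<K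
  Upper-pair a≢p _ _ b<K (inj₁ (a≤p , p≤2a)) (inj₂ (_ , p+K≤2b)) =
    suc-+≉p (≤∧≢⇒< a≤p a≢p) p≤2a (≤-trans (m≤m+n p K) p+K≤2b) b<K
  Upper-pair {a} {b} _ b≢p a<K _ (inj₂ (_ , p+K≤2a)) (inj₁ (b≤p , p≤2b)) sum≋ =
    suc-+≉p (≤∧≢⇒< b≤p b≢p) p≤2b (≤-trans (m≤m+n p K) p+K≤2a) a<K
      (≋-trans (≡⇒≋ (cong suc (+-comm b a))) sum≋)
  Upper-pair {a} {b} _ _ a<K b<K (inj₂ (_ , p+K≤2a)) (inj₂ (_ , p+K≤2b)) sum≋ =
    ≉-within-period (s≤s (halve-≤ a b p+K≤2a p+K≤2b))
      (subst (suc (a + b) <_) (sym (+-assoc p K K)) (<-≤-trans (suc-+-< a<K b<K) (m≤n+m _ p)))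
      (≋-sym (≋-trans sum≋ p≋p+K))
    where
    p≋p+K : p ≋ p + K mod K
    p≋p+K = ≋-trans (≡⇒≋ (sym (+-identityʳ p))) (+-cong ≋-refl (≋-sym N≋0))

module Position (K : ℕ) .{{_ : NonZero K}} {d e : ℕ} (e*d≋1 : e * d ≋ 1 mod K)
                {μ : ℕ} (μ<K : μ < K) where
  open Doubling K

  offset : ℕ
  offset = K ∸ μ

  pos : ℕ → ℕ
  pos α = e * (α + offset) % K

  pivot : ℕ
  pivot = pos (opp μ)

  pos<K : ∀ α → pos α < K
  pos<K α = m%n<n (e * (α + offset)) K

  pos-μ≡0 : pos μ ≡ 0
  pos-μ≡0 = trans (cong (λ s → e * s % K) (m+[n∸m]≡n (<⇒≤ μ<K))) (m*n%n≡0 e K)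

  pos-injective : ∀ {α β} → α < K → β < K → pos α ≡ pos β → α ≡ β
  pos-injective {α} {β} α<K β<K pos≡ =
    ≋⇒≡ α<K β<K (+-cancelʳ-≋ α β offset (*-cancel-unit {e = e} {u = d} e*d≋1 (begin
      e * (α + offset)   ≈⟨ %-≋ (e * (α + offset)) ⟨
      pos α              ≡⟨ pos≡ ⟩
      pos β              ≈⟨ %-≋ (e * (β + offset)) ⟩
      e * (β + offset)   ∎)))
    where open ≋-Reasoning K

  pos≢0 : ∀ {α} → α < K → α ≢ μ → pos α ≢ 0
  pos≢0 α<K α≢μ pos≡0 = α≢μ (pos-injective α<K μ<K (trans pos≡0 (sym pos-μ≡0)))

  pos≢pivot : ∀ {α} → α < K → α ≢ opp μ → pos α ≢ pivot
  pos≢pivot α<K α≢opp pos≡ = α≢opp (pos-injective α<K (opp<K μ<K) pos≡)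

  pos-step : ∀ {α β} → α ≋ β + d mod K → pos α ≋ suc (pos β) mod K
  pos-step {α} {β} α≋β+d = begin
    pos α                      ≈⟨ %-≋ (e * (α + offset)) ⟩
    e * (α + offset)           ≈⟨ *-cong (≋-refl {a = e}) (+-cong α≋β+d ≋-refl) ⟩
    e * (β + d + offset)       ≡⟨ distrib e β d offset ⟩
    e * (β + offset) + e * d   ≈⟨ +-cong (≋-sym (%-≋ (e * (β + offset)))) e*d≋1 ⟩
    pos β + 1                  ≡⟨ +-comm (pos β) 1 ⟩
    suc (pos β)                ∎
    where
    open ≋-Reasoning K
    distrib : ∀ e β d o → e * (β + d + o) ≡ e * (β + o) + e * d
    distrib = solve-∀

  pos-+ : ∀ α β → pos α + pos β ≋ e * (α + β + 2 * offset) mod K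
  pos-+ α β = begin
    pos α + pos β                         ≈⟨ +-cong (%-≋ _) (%-≋ _) ⟩
    e * (α + offset) + e * (β + offset)   ≡⟨ collect e α β offset ⟩
    e * (α + β + 2 * offset)              ∎
    where
    open ≋-Reasoning K
    collect : ∀ e a b o → e * (a + o) + e * (b + o) ≡ e * (a + b + 2 * o)
    collect = solve-∀

  pos-opp : ∀ {α} → α < K → pos α + pos (opp α) ≋ pivot mod K
  pos-opp {α} α<K = begin
    pos α + pos (opp α)              ≈⟨ pos-+ α (opp α) ⟩
    e * (α + opp α + 2 * offset)     ≡⟨ cong (λ s → e * (s + 2 * offset)) (opp-sum α<K μ<K) ⟩
    e * (μ + opp μ + 2 * offset)     ≈⟨ pos-+ μ (opp μ) ⟨
    pos μ + pivot                    ≡⟨ cong (_+ pivot) pos-μ≡0 ⟩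
    pivot                            ∎
    where open ≋-Reasoning K

  odd-step : ∀ {α β} → suc (2 * α) ≋ suc (2 * β) + 2 * d mod M → pos α ≋ suc (pos β) mod K
  odd-step {α} {β} eq =
    pos-step (halve-odd-≋ (≋-trans eq (≡⇒≋ (cong suc (sym (*-distribˡ-+ 2 β d))))))

  odd-sum : ∀ {α β} → β < K → suc (2 * α) + suc (2 * β) ≋ 2 * d mod M →
            pos α + pos β ≋ suc pivot mod K
  odd-sum {α} {β} β<K eq = begin
    pos α + pos β               ≈⟨ +-cong (pos-step α≋opp-β+d) ≋-refl ⟩
    suc (pos (opp β)) + pos β   ≡⟨ cong suc (+-comm (pos (opp β)) (pos β)) ⟩
    suc (pos β + pos (opp β))   ≈⟨ +-cong (≋-refl {a = 1}) (pos-opp β<K) ⟩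
    suc pivot                   ∎
    where
    open ≋-Reasoning K
    double : ∀ α β → 2 * (α + suc β) ≡ suc (2 * α) + suc (2 * β)
    double = solve-∀
    α≋opp-β+d : α ≋ opp β + d mod K
    α≋opp-β+d = +-cancelʳ-≋ α (opp β + d) (suc β) (begin
      α + suc β           ≈⟨ halve-≋ (≋-trans (≡⇒≋ (double α β)) eq) ⟩
      d                   ≈⟨ +-cong (≋-sym N≋0) ≋-refl ⟩
      K + d               ≡⟨ cong (_+ d) (suc+opp β<K) ⟨
      suc β + opp β + d   ≡⟨ xy∙z≈yz∙x (suc β) (opp β) d ⟩
      opp β + d + suc β   ∎)

  odd-sum-opp : ∀ {α β} → α < K → suc (2 * α) + suc (2 * β) + 2 * d ≋ 0 mod M →
                suc (pos α + pos β) ≋ pivot mod K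
  odd-sum-opp {α} {β} α<K eq = begin
    suc (pos α + pos β)   ≡⟨ +-suc (pos α) (pos β) ⟨
    pos α + suc (pos β)   ≈⟨ +-cong (≋-refl {a = pos α}) (pos-step opp-α≋β+d) ⟨
    pos α + pos (opp α)   ≈⟨ pos-opp α<K ⟩
    pivot                 ∎
    where
    open ≋-Reasoning K
    double : ∀ α β d → 2 * (suc α + (β + d)) ≡ suc (2 * α) + suc (2 * β) + 2 * d
    double = solve-∀
    opp-α≋β+d : opp α ≋ β + d mod K
    opp-α≋β+d = +-cancelˡ-≋ (opp α) (β + d) (suc α) (begin
      suc α + opp α     ≡⟨ suc+opp α<K ⟩
      K                 ≈⟨ N≋0 ⟩
      0                 ≈⟨ halve-≋ (≋-trans (≡⇒≋ (double α β d)) eq) ⟨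
      suc α + (β + d)   ∎)

data Halving : ℕ → Set where
  even : ∀ α → Halving (2 * α)
  odd  : ∀ α → Halving (suc (2 * α))

halving : ∀ x → Halving x
halving zero = even 0
halving (suc x) with halving x
... | even α = odd α
... | odd α  = subst Halving (*-suc 2 α) (even (suc α))

module Recolouring (K : ℕ) .{{_ : NonZero K}} {d e : ℕ} (1≤d : 1 ≤ d)
                   (e*d≋1 : e * d ≋ 1 mod K) {μ : ℕ} (μ<K : μ < K) where
  open Doubling K
  open Position K {d} {e} e*d≋1 μ<K
  open Arcs K pivot (pos<K (opp μ))

  data Rounding : ℕ → Set where
    exact : ∀ α → Rounding (2 * α)
    down  : ∀ α → ¬ Upper (pos α) → Rounding (suc (2 * α))
    up    : ∀ α → Upper (pos α) → Rounding (suc (2 * α))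

  round : ∀ x → Rounding x
  round x with halving x
  ... | even α = exact α
  ... | odd α with upper? (pos α)
  ...   | yes u  = up α u
  ...   | no ¬u  = down α ¬u

  value : ∀ {x} → Rounding x → ℕ
  value (exact α)  = α
  value (down α _) = α
  value (up α _)   = suc α % K

  lowered : ∀ {x} → Rounding x → ℕ
  lowered (down _ _) = 1
  lowered _          = 0

  raised : ∀ {x} → Rounding x → ℕ
  raised (up _ _) = 1
  raised _        = 0

  value<K : ∀ {x} → x < M → (r : Rounding x) → value r < K
  value<K 2α<M   (exact α)  = *-cancelˡ-< 2 α K 2α<M
  value<K 2α+1<M (down _ _) = odd<⇒< 2α+1<M
  value<K _      (up α _)   = m%n<n (suc α) K

  lowered≤1 : ∀ {x} (r : Rounding x) → lowered r ≤ 1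
  lowered≤1 (exact _)  = z≤n
  lowered≤1 (down _ _) = s≤s z≤n
  lowered≤1 (up _ _)   = z≤n

  raised≤1 : ∀ {x} (r : Rounding x) → raised r ≤ 1
  raised≤1 (exact _)  = z≤n
  raised≤1 (down _ _) = z≤n
  raised≤1 (up _ _)   = s≤s z≤n

  rounding-halves : ∀ {x} (r : Rounding x) → Halves (value r) (lowered r) x (raised r)
  rounding-halves (exact α)  = halves ≋-refl
  rounding-halves (down α _) =
    halves (≡⇒≋ (trans (+-comm (2 * α) 1) (sym (+-identityʳ (suc (2 * α))))))
  rounding-halves (up α _)   = halves (begin
    2 * (suc α % K) + 0   ≡⟨ +-identityʳ _ ⟩
    2 * (suc α % K)       ≈⟨ double-%-≋ (suc α) ⟩
    2 * suc α             ≡⟨ 2*suc α ⟩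
    2 * α + 2             ≡⟨ +-suc (2 * α) 1 ⟩
    suc (2 * α) + 1       ∎)
    where open ≋-Reasoning M

  Avoids : ℕ → Set
  Avoids x = x ≢ suc (2 * μ) × x ≢ suc (2 * opp μ)

  avoids⇒pos≢0 : ∀ {α} → suc (2 * α) < M → Avoids (suc (2 * α)) → pos α ≢ 0
  avoids⇒pos≢0 x<M (x≢ , _) = pos≢0 (odd<⇒< x<M) (x≢ ∘ cong (λ β → suc (2 * β)))

  avoids⇒pos≢pivot : ∀ {α} → suc (2 * α) < M → Avoids (suc (2 * α)) → pos α ≢ pivot
  avoids⇒pos≢pivot x<M (_ , x≢) = pos≢pivot (odd<⇒< x<M) (x≢ ∘ cong (λ β → suc (2 * β)))

  Upper-step : ∀ {α β} → suc (2 * α) < M → suc (2 * β) < M →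
               Avoids (suc (2 * α)) → Avoids (suc (2 * β)) →
               suc (2 * α) ≋ suc (2 * β) + 2 * d mod M → Upper (pos β) → Upper (pos α)
  Upper-step {α} {β} x<M y<M avx avy x≋y+2d upβ =
    subst Upper suc-pos-β≡pos-α (Upper-suc (avoids⇒pos≢pivot y<M avy) upβ)
    where
    suc-pos-β≡pos-α : suc (pos β) ≡ pos α
    suc-pos-β≡pos-α = ≋⇒≡-≤ (pos<K β) (n≢0⇒n>0 (avoids⇒pos≢0 x<M avx)) (pos<K α)
                        (≋-sym (odd-step x≋y+2d))

  plus-tight : ∀ {x y} → x < M → y < M → Avoids x → Avoids y →
               (rx : Rounding x) (ry : Rounding y) → lowered rx + raised ry ≡ 2 →
               ¬ (x ≋ y + 2 * d mod M)
  plus-tight x<M y<M avx avy (down α ¬upα) (up β upβ) _ x≋y+2d =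
    ¬upα (Upper-step x<M y<M avx avy x≋y+2d upβ)
  plus-tight _ _ _ _ (down _ _) (exact _)  ()
  plus-tight _ _ _ _ (down _ _) (down _ _) ()
  plus-tight _ _ _ _ (exact _)  ry two = contradiction two (<⇒≢ (s≤s (raised≤1 ry)))
  plus-tight _ _ _ _ (up _ _)   ry two = contradiction two (<⇒≢ (s≤s (raised≤1 ry)))

  minus-tight-low : ∀ {x y} → x < M → y < M → Avoids x → Avoids y →
                    (rx : Rounding x) (ry : Rounding y) → lowered rx + lowered ry ≡ 2 →
                    ¬ (x + y ≋ 2 * d mod M)
  minus-tight-low x<M y<M avx avy (down α ¬upα) (down β ¬upβ) _ x+y≋2d =
    Lower-pair (n≢0⇒n>0 (avoids⇒pos≢0 x<M avx)) (n≢0⇒n>0 (avoids⇒pos≢0 y<M avy))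
      (pos<K α) (pos<K β)
      (¬Upper⇒Lower (avoids⇒pos≢pivot x<M avx) ¬upα)
      (¬Upper⇒Lower (avoids⇒pos≢pivot y<M avy) ¬upβ)
      (odd-sum (odd<⇒< y<M) x+y≋2d)
  minus-tight-low _ _ _ _ (down _ _) (exact _) ()
  minus-tight-low _ _ _ _ (down _ _) (up _ _)  ()
  minus-tight-low _ _ _ _ (exact _)  ry two = contradiction two (<⇒≢ (s≤s (lowered≤1 ry)))
  minus-tight-low _ _ _ _ (up _ _)   ry two = contradiction two (<⇒≢ (s≤s (lowered≤1 ry)))

  minus-tight-high : ∀ {x y} → x < M → y < M → Avoids x → Avoids y →
                     (rx : Rounding x) (ry : Rounding y) → raised rx + raised ry ≡ 2 →
                     ¬ (x + y + 2 * d ≋ 0 mod M)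
  minus-tight-high x<M y<M avx avy (up α upα) (up β upβ) _ x+y+2d≋0 =
    Upper-pair (avoids⇒pos≢pivot x<M avx) (avoids⇒pos≢pivot y<M avy)
      (pos<K α) (pos<K β) upα upβ (odd-sum-opp (odd<⇒< x<M) x+y+2d≋0)
  minus-tight-high _ _ _ _ (up _ _)   (exact _)  ()
  minus-tight-high _ _ _ _ (up _ _)   (down _ _) ()
  minus-tight-high _ _ _ _ (exact _)  ry two = contradiction two (<⇒≢ (s≤s (raised≤1 ry)))
  minus-tight-high _ _ _ _ (down _ _) ry two = contradiction two (<⇒≢ (s≤s (raised≤1 ry)))

  plus-edge : ∀ {x y} → x < M → y < M → Avoids x → Avoids y →
              (rx : Rounding x) (ry : Rounding y) →
              2 * d ≤ circ M ((x + (M ∸ y)) % M) →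
              d ≤ circ K ((value rx + (K ∸ value ry)) % K)
  plus-edge {x} {y} x<M y<M avx avy rx ry 2d≤circ =
    bound 1≤d (m%n<n _ K) (m%n<n _ M) 2d≤circ
      (+-mono-≤ (lowered≤1 rx) (raised≤1 ry)) (+-mono-≤ (raised≤1 rx) (lowered≤1 ry))
      (Halves-+ (rounding-halves rx)
                (Halves-negate (rounding-halves ry) (<⇒≤ (value<K y<M ry)) (<⇒≤ y<M)))
      (λ two → plus-tight x<M y<M avx avy rx ry two ∘ x≋y+2d)
      (λ two → plus-tight y<M x<M avy avx ry rx (trans (+-comm (lowered ry) (raised rx)) two)
                 ∘ y≋x+2d)
    where
    open ≋-Reasoning M
    D : ℕ
    D = (x + (M ∸ y)) % M
    D+y≋x : D + y ≋ x mod M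
    D+y≋x = begin
      D + y             ≈⟨ +-cong (%-≋ (x + (M ∸ y))) ≋-refl ⟩
      x + (M ∸ y) + y   ≡⟨ +-assoc x (M ∸ y) y ⟩
      x + (M ∸ y + y)   ≡⟨ cong (x +_) (m∸n+n≡m (<⇒≤ y<M)) ⟩
      x + M             ≈⟨ +-cong ≋-refl N≋0 ⟩
      x + 0             ≡⟨ +-identityʳ x ⟩
      x                 ∎
    x≋y+2d : D ≡ 2 * d → x ≋ y + 2 * d mod M
    x≋y+2d D≡2d = begin
      x           ≈⟨ D+y≋x ⟨
      D + y       ≡⟨ cong (_+ y) D≡2d ⟩
      2 * d + y   ≡⟨ +-comm (2 * d) y ⟩
      y + 2 * d   ∎
    y≋x+2d : D + 2 * d ≡ M → y ≋ x + 2 * d mod M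
    y≋x+2d D+2d≡M = begin
      y               ≈⟨ +-cong (≋-sym N≋0) ≋-refl ⟩
      M + y           ≡⟨ cong (_+ y) D+2d≡M ⟨
      D + 2 * d + y   ≡⟨ xy∙z≈xz∙y D (2 * d) y ⟩
      D + y + 2 * d   ≈⟨ +-cong D+y≋x ≋-refl ⟩
      x + 2 * d       ∎

  minus-edge : ∀ {x y} → x < M → y < M → Avoids x → Avoids y →
               (rx : Rounding x) (ry : Rounding y) →
               2 * d ≤ circ M ((x + y) % M) →
               d ≤ circ K ((value rx + value ry) % K)
  minus-edge {x} {y} x<M y<M avx avy rx ry 2d≤circ =
    bound 1≤d (m%n<n _ K) (m%n<n _ M) 2d≤circ
      (+-mono-≤ (lowered≤1 rx) (lowered≤1 ry)) (+-mono-≤ (raised≤1 rx) (raised≤1 ry))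
      (Halves-+ (rounding-halves rx) (rounding-halves ry))
      (λ two D≡2d → minus-tight-low x<M y<M avx avy rx ry two
                      (≋-trans (≋-sym (%-≋ (x + y))) (≡⇒≋ D≡2d)))
      (λ two D+2d≡M → minus-tight-high x<M y<M avx avy rx ry two
                        (≋-trans (+-cong (≋-sym (%-≋ (x + y))) ≋-refl)
                                 (≋-trans (≡⇒≋ D+2d≡M) N≋0)))

  recolour : Fin M → Fin K
  recolour x = fromℕ< (value<K (toℕ<n x) (round (toℕ x)))

  recolour-edge : ∀ s (x y : Fin M) → Avoids (toℕ x) → Avoids (toℕ y) →
                  2 * d ≤ circ M (residue M s x y) →
                  d ≤ circ K (residue K s (recolour x) (recolour y))
  recolour-edge plus x y avx avy 2d≤circ
    rewrite toℕ-fromℕ< (value<K (toℕ<n x) (round (toℕ x)))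
          | toℕ-fromℕ< (value<K (toℕ<n y) (round (toℕ y))) =
    plus-edge (toℕ<n x) (toℕ<n y) avx avy (round (toℕ x)) (round (toℕ y)) 2d≤circ
  recolour-edge minus x y avx avy 2d≤circ
    rewrite toℕ-fromℕ< (value<K (toℕ<n x) (round (toℕ x)))
          | toℕ-fromℕ< (value<K (toℕ<n y) (round (toℕ y))) =
    minus-edge (toℕ<n x) (toℕ<n y) avx avy (round (toℕ x)) (round (toℕ y)) 2d≤circ

module _ {n K : ℕ} (c : Fin n → ℕ) (s t : Fin K → ℕ) where

  Avoided : Fin K → Set
  Avoided i = ∀ v → c v ≢ s i × c v ≢ t i

  avoids? : ∀ i v → Dec (c v ≢ s i × c v ≢ t i)
  avoids? i v = ¬? (c v ≟ s i) ×-dec ¬? (c v ≟ t i)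

  Hit : Fin K → Fin n ⊎ Fin n → Set
  Hit i (inj₁ v) = c v ≡ s i
  Hit i (inj₂ v) = c v ≡ t i

  hit : ∀ i → ¬ Avoided i → ∃ (Hit i)
  hit i ¬avoided with ¬∀⟶∃¬ n _ (avoids? i) ¬avoided
  ... | v , ¬avoids with c v ≟ s i | c v ≟ t i
  ...   | yes cv≡si | _         = inj₁ v , cv≡si
  ...   | no _      | yes cv≡ti = inj₂ v , cv≡ti
  ...   | no cv≢si  | no cv≢ti  = contradiction (cv≢si , cv≢ti) ¬avoids

  avoided-pair : (∀ {i j} → s i ≡ s j → i ≡ j) → (∀ {i j} → t i ≡ t j → i ≡ j) → 2 * n < K →
                 ∃ Avoided
  avoided-pair s-injective t-injective 2n<K with any? (all? ∘ avoids?)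
  ... | yes found = found
  ... | no none   = ⊥-elim (no-collision (pigeonhole n+n<K (join n n ∘ witness)))
    where
    witness : Fin K → Fin n ⊎ Fin n
    witness i = proj₁ (hit i (none ∘ (i ,_)))

    witness-hits : ∀ i → Hit i (witness i)
    witness-hits i = proj₂ (hit i (none ∘ (i ,_)))

    hit-injective : ∀ {i j} z → Hit i z → Hit j z → i ≡ j
    hit-injective (inj₁ v) cv≡si cv≡sj = s-injective (trans (sym cv≡si) cv≡sj)
    hit-injective (inj₂ v) cv≡ti cv≡tj = t-injective (trans (sym cv≡ti) cv≡tj)

    n+n<K : n + n < K
    n+n<K = subst (_< K) (cong (n +_) (+-identityʳ n)) 2n<K

    no-collision : ¬ (∃₂ λ i j → toℕ i < toℕ j × join n n (witness i) ≡ join n n (witness j))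
    no-collision (i , j , i<j , same-join) = <-irrefl (cong toℕ i≡j) i<j
      where
      same : witness i ≡ witness j
      same = trans (sym (splitAt-join n n (witness i)))
                   (trans (cong (splitAt n) same-join) (splitAt-join n n (witness j)))
      i≡j : i ≡ j
      i≡j = hit-injective (witness i) (witness-hits i) (subst (Hit j) (sym same) (witness-hits j))

lemma7 : (n k d : ℕ) .{{_ : NonZero k}} → 1 ≤ d → 2 * d ≤ k → gcd k d ≡ 1 →
    (G : SignedGraph n) → HasColoring G (2 * k) (2 * d) {{m*n≢0 2 k}} → 2 * n < k →
    HasColoring G k d
lemma7 n k d 1≤d _ gcd≡1 G (c , c-proper) 2n<k = recolour ∘ c , recolour-proper
  where
  open Doubling k

  inverse : ∃[ e ] e * d ≋ 1 mod k
  inverse = modular-inverse gcd≡1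

  odd-injective : ∀ {i j : Fin k} → suc (2 * toℕ i) ≡ suc (2 * toℕ j) → i ≡ j
  odd-injective = toℕ-injective ∘ *-cancelˡ-≡ _ _ 2 ∘ suc-injective

  odd-opp-injective : ∀ {i j : Fin k} → suc (2 * opp (toℕ i)) ≡ suc (2 * opp (toℕ j)) → i ≡ j
  odd-opp-injective {i} {j} =
    toℕ-injective ∘ opp-injective (toℕ<n i) (toℕ<n j) ∘ *-cancelˡ-≡ _ _ 2 ∘ suc-injective

  avoided : ∃[ μ ] ∀ v → toℕ (c v) ≢ suc (2 * toℕ μ) × toℕ (c v) ≢ suc (2 * opp (toℕ μ))
  avoided = avoided-pair (toℕ ∘ c) _ _ odd-injective odd-opp-injective 2n<k

  open Recolouring k {e = proj₁ inverse} 1≤d (proj₂ inverse) (toℕ<n (proj₁ avoided))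

  recolour-proper : IsColoring G k d (recolour ∘ c)
  recolour-proper {v} {w} edge = recolour-edge (SignedGraph.σ G edge) (c v) (c w)
    (proj₂ avoided v) (proj₂ avoided w) (c-proper edge)
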